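{- Let $H^{(v)}$ be a rooted simple graph with root $v$, and let $A^{(v)}(H)$ be the matrix obtained from the adjacency matrix $A(H)$ by deleting the row and column corresponding to $v$. Suppose that either (i) $\det A(H)=\pm 1$ and $\det A^{(v)}(H)=0$, or (ii) $\det A(H)=0$ and $\det A^{(v)}(H)=\pm1$. Then $\det A(G\circ H^{(v)})=\pm 1$ for every simple graph $G$ with $\det A(G)=\pm 1$.
   Context: $A(\cdot)$ denotes the adjacency matrix. The rooted product $G\circ H^{(v)}$ of a graph $G$ with vertices $1,\dots,n$ and a rooted graph $H^{(v)}$ is obtained from $G$ and $n$ copies of $H$ by identifying the root $v$ of the $i$th copy with vertex $i$ of $G$, for each $i$. -}

module Defs where

open import Data.Nat using (ℕ; zero; suc) renaming (_*_ to _*ℕ_)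
open import Data.Fin using (Fin; zero; suc; punchIn; remQuot; toℕ; _≟_)
open import Data.Integer using (ℤ; 0ℤ; 1ℤ; -1ℤ; _+_; _*_; -_)
open import Data.Bool using (Bool; true; false; _∧_; _∨_; if_then_else_)
open import Data.Product using (_,_)
open import Data.Sum using (_⊎_)
open import Relation.Nullary.Decidable using (⌊_⌋)
open import Relation.Binary.PropositionalEquality using (_≡_)

Matrix : ℕ → Set
Matrix n = Fin n → Fin n → ℤ

sumFin : ∀ {n} → (Fin n → ℤ) → ℤ
sumFin {zero}  f = 0ℤ
sumFin {suc n} f = f zero + sumFin (λ i → f (suc i))

sign : ℕ → ℤ
sign zero    = 1ℤ
sign (suc k) = - sign k

det : ∀ {n} → Matrix n → ℤ
det {zero}  M = 1ℤ
det {suc n} M =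
  sumFin (λ j → sign (toℕ j) * (M zero j * det (λ r c → M (suc r) (punchIn j c))))

record Graph (n : ℕ) : Set where
  field
    adj    : Fin n → Fin n → Bool
    adj-sym : ∀ i j → adj i j ≡ adj j i
    adj-irrefl : ∀ i → adj i i ≡ false
open Graph public

boolToℤ : Bool → ℤ
boolToℤ true  = 1ℤ
boolToℤ false = 0ℤ

A : ∀ {n} → Graph n → Matrix n
A G i j = boolToℤ (adj G i j)

deleteRowCol : ∀ {k} → Fin (suc k) → Matrix (suc k) → Matrix k
deleteRowCol v M r c = M (punchIn v r) (punchIn v c)

A⁽_⁾ : ∀ {k} → Fin (suc k) → Graph (suc k) → Matrix k
A⁽ v ⁾ H = deleteRowCol v (A H)

eqFin : ∀ {n} → Fin n → Fin n → Bool
eqFin i j = ⌊ i ≟ j ⌋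

-- Rooted product G ∘ H^{(v)}: vertex set Fin (n * k), the vertex
-- combine i a (decoded by remQuot) is vertex a of the i-th copy of H,
-- and the root (i , v) of the i-th copy is identified with vertex i of G.
rootedProductAdj : ∀ {n k} → Graph n → Graph k → Fin k → Fin (n *ℕ k) → Fin (n *ℕ k) → Bool
rootedProductAdj {n} {k} G H v x y with remQuot {n} k x | remQuot {n} k y
... | i , a | j , b =
  (eqFin i j ∧ adj H a b) ∨ (eqFin a v ∧ eqFin b v ∧ adj G i j)

A-rooted : ∀ {n k} → Graph n → Graph k → Fin k → Matrix (n *ℕ k)
A-rooted G H v x y = boolToℤ (rootedProductAdj G H v x y)

IsUnitDet : ℤ → Set
IsUnitDet d = d ≡ 1ℤ ⊎ d ≡ -1ℤ

-- Write B = A(H) and X = A(G). Ordering the vertices of G ∘ H^(v) copy by copy,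
-- A(G ∘ H^(v)) = I ⊗ B + X ⊗ E_vv: it differs from the block diagonal matrix I ⊗ B
-- only in the n root rows. Let w be the v-th column of adj B; by symmetry of B,
-- Σ_a w_a B_ab = det B · δ_bv, and w_v = det A^(v)(H).
-- (i) Adding det B · Σ_j X_ij Σ_a w_a (row a of copy j) to the root row of copy i turns
--     I ⊗ B into A(G ∘ H^(v)), because (det B)² = 1; no root row is used since w_v = 0.
--     Row operations preserve the determinant, so det A(G ∘ H^(v)) = (det B)^n.
-- (ii) Adding det A^(v)(H) · Σ_a≠v w_a (row a of copy i) to the root row of copy i turns it
--     into X_i ⊗ e_v, because then Σ_a≠v w_a B_ab = - det A^(v)(H) · B_vb and (det A^(v)(H))² = 1.
--     The determinant of the result is alternating multilinear in X, hence det X times its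
--     value at X = I, a block diagonal matrix whose blocks have determinant det A^(v)(H).

module Submission where

open import Defs
open import Data.Nat as ℕ using (ℕ; zero; suc; _<ᵇ_)
import Data.Nat.Properties as ℕ
open import Data.Fin as Fin using (Fin; zero; suc; punchIn; punchOut; toℕ; _↑ˡ_; _↑ʳ_; combine; remQuot)
import Data.Fin.Properties as Fin
open import Data.Integer using (ℤ; 0ℤ; 1ℤ; _+_; _*_; -_; _-_; _^_)
import Data.Integer.Properties as ℤ
open import Data.Integer.Tactic.RingSolver using (solve-∀)
open import Data.Bool using (Bool; true; false; _∧_; _∨_; if_then_else_)
open import Data.Bool.Properties using (∧-conicalʳ)
open import Data.Product using (Σ-syntax; _×_; _,_; proj₁; proj₂)
open import Data.Sum using (_⊎_; inj₁; inj₂)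
open import Data.Vec.Functional using (updateAt; insertAt)
open import Data.Vec.Functional.Properties using (updateAt-updates; updateAt-minimal; updateAt-updateAt; updateAt-commutes; map-updateAt; insertAt-lookup; insertAt-punchIn)
open import Function using (_∘_; const)
open import Function.Definitions using (Injective)
open import Relation.Binary.PropositionalEquality
open import Relation.Nullary using (yes; no; contradiction)
open import Algebra.Properties.AbelianGroup ℤ.+-0-abelianGroup using (identityˡ-unique; inverseˡ-unique)

δ : ∀ {n} → Fin n → Fin n → ℤ
δ i j = boolToℤ (eqFin i j)

module _ {n : ℕ} {i j : Fin n} where

  δ-≡ : i ≡ j → δ i j ≡ 1ℤ
  δ-≡ i≡j with i Fin.≟ j
  ... | yes _  = refl
  ... | no i≢j = contradiction i≡j i≢j

  δ-≢ : i ≢ j → δ i j ≡ 0ℤ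
  δ-≢ i≢j with i Fin.≟ j
  ... | yes i≡j = contradiction i≡j i≢j
  ... | no _    = refl

δ-refl : ∀ {n} (i : Fin n) → δ i i ≡ 1ℤ
δ-refl i = δ-≡ refl

δ-sym : ∀ {n} (i j : Fin n) → δ i j ≡ δ j i
δ-sym i j with i Fin.≟ j
... | yes i≡j = sym (δ-≡ (sym i≡j))
... | no i≢j  = sym (δ-≢ (i≢j ∘ sym))

δ-injective : ∀ {m n} {f : Fin m → Fin n} → Injective _≡_ _≡_ f → ∀ i j → δ (f i) (f j) ≡ δ i j
δ-injective f-inj i j with i Fin.≟ j
... | yes i≡j = δ-≡ (cong _ i≡j)
... | no i≢j  = δ-≢ (i≢j ∘ f-inj)

δ-suc : ∀ {n} (i j : Fin n) → δ (suc i) (suc j) ≡ δ i j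
δ-suc = δ-injective Fin.suc-injective

δ-punchIn : ∀ {n} (c : Fin (suc n)) l → δ c (punchIn c l) ≡ 0ℤ
δ-punchIn c l = δ-≢ (Fin.punchInᵢ≢i c l ∘ sym)

eqFin⇒≡ : ∀ {n} {a b : Fin n} → eqFin a b ≡ true → a ≡ b
eqFin⇒≡ {a = a} {b} eq with a Fin.≟ b
eqFin⇒≡ _  | yes a≡b = a≡b
eqFin⇒≡ () | no _

eqFin-refl : ∀ {n} (a : Fin n) → eqFin a a ≡ true
eqFin-refl a with a Fin.≟ a
... | yes _  = refl
... | no a≢a = contradiction refl a≢a

eqFin⇒≢ : ∀ {n} {a b : Fin n} → eqFin a b ≡ false → a ≢ b
eqFin⇒≢ {a = a} eq refl with () ← trans (sym (eqFin-refl a)) eq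

boolToℤ-∧ : ∀ x y → boolToℤ (x ∧ y) ≡ boolToℤ x * boolToℤ y
boolToℤ-∧ false false = refl
boolToℤ-∧ false true  = refl
boolToℤ-∧ true  false = refl
boolToℤ-∧ true  true  = refl

boolToℤ-∨ : ∀ x y → (x ≡ true → y ≡ false) → boolToℤ (x ∨ y) ≡ boolToℤ x + boolToℤ y
boolToℤ-∨ false false _ = refl
boolToℤ-∨ false true  _ = refl
boolToℤ-∨ true  false _ = refl
boolToℤ-∨ true  true  h with () ← h refl

sign-+ : ∀ a b → sign (a ℕ.+ b) ≡ sign a * sign b
sign-+ zero    b = sym (ℤ.*-identityˡ (sign b))
sign-+ (suc a) b = trans (cong -_ (sign-+ a b)) (ℤ.neg-distribˡ-* (sign a) (sign b))

sign-*-self : ∀ a → sign a * sign a ≡ 1ℤ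
sign-*-self zero    = refl
sign-*-self (suc a) = trans (neg*neg (sign a)) (sign-*-self a)
  where
  neg*neg : ∀ s → - s * - s ≡ s * s
  neg*neg = solve-∀

sign-suc-suc : ∀ a b → sign (suc a ℕ.+ suc b) ≡ sign (a ℕ.+ b)
sign-suc-suc a b rewrite ℕ.+-suc a b = ℤ.neg-involutive (sign (a ℕ.+ b))

<ᵇ-irrefl : ∀ m → (m <ᵇ m) ≡ false
<ᵇ-irrefl zero    = refl
<ᵇ-irrefl (suc m) = <ᵇ-irrefl m

<ᵇ-suc-self : ∀ m → (m <ᵇ suc m) ≡ true
<ᵇ-suc-self zero    = refl
<ᵇ-suc-self (suc m) = <ᵇ-suc-self m

<ᵇ-suc : ∀ {m t} → m ≢ t → (m <ᵇ suc t) ≡ (m <ᵇ t)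
<ᵇ-suc {zero}  {zero}  m≢t = contradiction refl m≢t
<ᵇ-suc {zero}  {suc t} m≢t = refl
<ᵇ-suc {suc m} {zero}  m≢t = refl
<ᵇ-suc {suc m} {suc t} m≢t = <ᵇ-suc (m≢t ∘ cong suc)

toℕ-<ᵇ : ∀ {n} (r : Fin n) → (toℕ r <ᵇ n) ≡ true
toℕ-<ᵇ zero    = refl
toℕ-<ᵇ (suc r) = toℕ-<ᵇ r

sumFin-cong : ∀ {n} {f g : Fin n → ℤ} → (∀ i → f i ≡ g i) → sumFin f ≡ sumFin g
sumFin-cong {zero}  f≗g = refl
sumFin-cong {suc n} f≗g = cong₂ _+_ (f≗g zero) (sumFin-cong (f≗g ∘ suc))

sumFin-zero : ∀ {n} {f : Fin n → ℤ} → (∀ i → f i ≡ 0ℤ) → sumFin f ≡ 0ℤ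
sumFin-zero {zero}  f≗0 = refl
sumFin-zero {suc n} f≗0 = cong₂ _+_ (f≗0 zero) (sumFin-zero (f≗0 ∘ suc))

sumFin-+ : ∀ {n} (f g : Fin n → ℤ) → sumFin (λ i → f i + g i) ≡ sumFin f + sumFin g
sumFin-+ {zero}  f g = refl
sumFin-+ {suc n} f g =
  trans (cong (f zero + g zero +_) (sumFin-+ (f ∘ suc) (g ∘ suc)))
        (middle-swap (f zero) (g zero) (sumFin (f ∘ suc)) (sumFin (g ∘ suc)))
  where
  middle-swap : ∀ a b c d → a + b + (c + d) ≡ a + c + (b + d)
  middle-swap = solve-∀

sumFin-*ˡ : ∀ {n} a (f : Fin n → ℤ) → sumFin (λ i → a * f i) ≡ a * sumFin f
sumFin-*ˡ {zero}  a f = sym (ℤ.*-zeroʳ a)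
sumFin-*ˡ {suc n} a f =
  trans (cong (a * f zero +_) (sumFin-*ˡ a (f ∘ suc))) (sym (ℤ.*-distribˡ-+ a (f zero) _))

sumFin-*ʳ : ∀ {n} a (f : Fin n → ℤ) → sumFin (λ i → f i * a) ≡ sumFin f * a
sumFin-*ʳ a f =
  trans (sumFin-cong (λ i → ℤ.*-comm (f i) a)) (trans (sumFin-*ˡ a f) (ℤ.*-comm a (sumFin f)))

sumFin-linear : ∀ {n} a (f g : Fin n → ℤ) → sumFin (λ i → a * f i + g i) ≡ a * sumFin f + sumFin g
sumFin-linear a f g = trans (sumFin-+ (λ i → a * f i) g) (cong (_+ sumFin g) (sumFin-*ˡ a f))

sumFin-punchIn : ∀ {n} (c : Fin (suc n)) (f : Fin (suc n) → ℤ) →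
  sumFin f ≡ f c + sumFin (f ∘ punchIn c)
sumFin-punchIn zero f = refl
sumFin-punchIn {suc n} (suc c) f =
  trans (cong (f zero +_) (sumFin-punchIn c (f ∘ suc)))
        (left-swap (f zero) (f (suc c)) (sumFin (f ∘ suc ∘ punchIn c)))
  where
  left-swap : ∀ a b c → a + (b + c) ≡ b + (a + c)
  left-swap = solve-∀

sumFin-↑ : ∀ p {q} (f : Fin (p ℕ.+ q) → ℤ) →
  sumFin f ≡ sumFin (λ i → f (i ↑ˡ q)) + sumFin (λ j → f (p ↑ʳ j))
sumFin-↑ zero    f = sym (ℤ.+-identityˡ _)
sumFin-↑ (suc p) f = trans (cong (f zero +_) (sumFin-↑ p (f ∘ suc))) (sym (ℤ.+-assoc (f zero) _ _))

sumFin-δ : ∀ {n} (c : Fin n) (f : Fin n → ℤ) → sumFin (λ i → δ c i * f i) ≡ f c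
sumFin-δ {suc n} c f = begin
  sumFin (λ i → δ c i * f i)                                   ≡⟨ sumFin-punchIn c (λ i → δ c i * f i) ⟩
  δ c c * f c + sumFin (λ l → δ c (punchIn c l) * f (punchIn c l))
    ≡⟨ cong₂ _+_ (cong (_* f c) (δ-refl c)) (sumFin-zero (λ l → cong (_* f (punchIn c l)) (δ-punchIn c l))) ⟩
  1ℤ * f c + 0ℤ                                                 ≡⟨ trans (ℤ.+-identityʳ _) (ℤ.*-identityˡ _) ⟩
  f c                                                           ∎
  where open ≡-Reasoning

sumFin-δʳ : ∀ {n} (c : Fin n) (f : Fin n → ℤ) → sumFin (λ i → f i * δ i c) ≡ f c
sumFin-δʳ c f =
  trans (sumFin-cong (λ i → trans (ℤ.*-comm (f i) (δ i c)) (cong (_* f i) (δ-sym i c)))) (sumFin-δ c f)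

infix 4 _≋_
_≋_ : ∀ {m n} → (Fin m → Fin n → ℤ) → (Fin m → Fin n → ℤ) → Set
M ≋ N = ∀ i j → M i j ≡ N i j

_[_]≔_ : ∀ {n} {A : Set} → (Fin n → A) → Fin n → A → Fin n → A
xs [ r ]≔ x = updateAt xs r (const x)

module _ {m n : ℕ} (M : Fin m → Fin n → ℤ) (r : Fin m) where

  []≔-updates : ∀ {x} j → (M [ r ]≔ x) r j ≡ x j
  []≔-updates j = cong-app (updateAt-updates r M) j

  []≔-minimal : ∀ {x i} → i ≢ r → ∀ j → (M [ r ]≔ x) i j ≡ M i j
  []≔-minimal {i = i} i≢r j = cong-app (updateAt-minimal i r M i≢r) j

  []≔-self : ∀ {x} → (∀ j → x j ≡ M r j) → M [ r ]≔ x ≋ M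
  []≔-self x≗Mr i j with i Fin.≟ r
  ... | yes refl = trans ([]≔-updates j) (x≗Mr j)
  ... | no i≢r   = []≔-minimal i≢r j

  []≔-cong : ∀ {x y} → (∀ j → x j ≡ y j) → M [ r ]≔ x ≋ M [ r ]≔ y
  []≔-cong x≗y i j with i Fin.≟ r
  ... | yes refl = trans ([]≔-updates j) (trans (x≗y j) (sym ([]≔-updates j)))
  ... | no i≢r   = trans ([]≔-minimal i≢r j) (sym ([]≔-minimal i≢r j))

  []≔-idem : ∀ x y → (M [ r ]≔ x) [ r ]≔ y ≋ M [ r ]≔ y
  []≔-idem x y i j = cong-app (updateAt-updateAt r M i) j

sumFin-[]≔0 : ∀ {n} (w g : Fin n → ℤ) v → sumFin (λ a → (w [ v ]≔ 0ℤ) a * g a) ≡ sumFin (λ a → w a * g a) - w v * g v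
sumFin-[]≔0 {suc n} w g v = begin
  sumFin (λ a → w′ a * g a)                                       ≡⟨ sumFin-punchIn v (λ a → w′ a * g a) ⟩
  w′ v * g v + sumFin (λ l → w′ (punchIn v l) * g (punchIn v l))
    ≡⟨ cong₂ _+_ (cong (_* g v) (updateAt-updates v w))
                 (sumFin-cong (λ l → cong (_* g (punchIn v l)) (updateAt-minimal (punchIn v l) v w (Fin.punchInᵢ≢i v l)))) ⟩
  0ℤ * g v + rest                                                 ≡⟨ cancel (w v * g v) rest ⟩
  (w v * g v + rest) - w v * g v                                  ≡⟨ cong (_- w v * g v) (sym (sumFin-punchIn v (λ a → w a * g a))) ⟩
  sumFin (λ a → w a * g a) - w v * g v                            ∎
  where
  open ≡-Reasoning
  w′ = w [ v ]≔ 0ℤ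
  rest = sumFin (λ l → w (punchIn v l) * g (punchIn v l))
  cancel : ∀ p r → 0ℤ + r ≡ (p + r) - p
  cancel = solve-∀

[]≔-submatrix : ∀ {m m′ n n′} {ρ : Fin m′ → Fin m} (φ : Fin n′ → Fin n) → Injective _≡_ _≡_ ρ →
  ∀ (M : Fin m → Fin n → ℤ) r x →
  (λ i j → (M [ ρ r ]≔ x) (ρ i) (φ j)) ≋ (λ i j → M (ρ i) (φ j)) [ r ]≔ (x ∘ φ)
[]≔-submatrix φ ρ-inj M r x i j with i Fin.≟ r
... | yes refl = trans ([]≔-updates M _ (φ j)) (sym ([]≔-updates _ r j))
... | no i≢r   = trans ([]≔-minimal M _ (i≢r ∘ ρ-inj) (φ j)) (sym ([]≔-minimal _ r i≢r j))

-- Multilinear and alternating forms; the determinant is one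

minor : ∀ {n} → Matrix (suc n) → Fin (suc n) → Fin (suc n) → Matrix n
minor M r c i j = M (punchIn r i) (punchIn c j)

det-cong : ∀ {n} {M N : Matrix n} → M ≋ N → det M ≡ det N
det-cong {zero}  M≋N = refl
det-cong {suc n} M≋N = sumFin-cong (λ j →
  cong₂ (λ a d → sign (toℕ j) * (a * d)) (M≋N zero j) (det-cong (λ r c → M≋N (suc r) (punchIn j c))))

det-[suc]≔ : ∀ {n} (M : Matrix (suc n)) r x →
  det (M [ suc r ]≔ x) ≡ sumFin (λ j → sign (toℕ j) * (M zero j * det (minor M zero j [ r ]≔ (x ∘ punchIn j))))
det-[suc]≔ M r x = sumFin-cong (λ j →
  cong (λ d → sign (toℕ j) * (M zero j * d)) (det-cong ([]≔-submatrix (punchIn j) Fin.suc-injective M r x)))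

det-linear : ∀ {n} (M : Matrix n) r a x y →
  det (M [ r ]≔ (λ j → a * x j + y j)) ≡ a * det (M [ r ]≔ x) + det (M [ r ]≔ y)
det-linear {suc n} M zero a x y =
  trans (sumFin-cong (λ j → distrib a (sign (toℕ j)) (x j) (y j) (det (minor M zero j))))
        (sumFin-linear a (λ j → sign (toℕ j) * (x j * det (minor M zero j))) (λ j → sign (toℕ j) * (y j * det (minor M zero j))))
  where
  distrib : ∀ a s x y d → s * ((a * x + y) * d) ≡ a * (s * (x * d)) + s * (y * d)
  distrib = solve-∀
det-linear {suc n} M (suc r) a x y = begin
  det (M [ suc r ]≔ (λ j → a * x j + y j))           ≡⟨ det-[suc]≔ M r _ ⟩
  sumFin (λ j → sign (toℕ j) * (M zero j * det (minor M zero j [ r ]≔ (λ c → a * x′ j c + y′ j c))))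
    ≡⟨ sumFin-cong (λ j → trans (cong (λ d → sign (toℕ j) * (M zero j * d))
                                      (det-linear (minor M zero j) r a (x′ j) (y′ j)))
                                (distrib a (sign (toℕ j)) (M zero j) (D x′ j) (D y′ j))) ⟩
  sumFin (λ j → a * term x′ j + term y′ j)             ≡⟨ sumFin-linear a (term x′) (term y′) ⟩
  a * sumFin (term x′) + sumFin (term y′)              ≡⟨ sym (cong₂ (λ s t → a * s + t) (det-[suc]≔ M r x) (det-[suc]≔ M r y)) ⟩
  a * det (M [ suc r ]≔ x) + det (M [ suc r ]≔ y)     ∎
  where
  open ≡-Reasoning
  x′ y′ : Fin (suc n) → Fin n → ℤ
  x′ j = x ∘ punchIn j
  y′ j = y ∘ punchIn j
  D : (Fin (suc n) → Fin n → ℤ) → Fin (suc n) → ℤ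
  D z j = det (minor M zero j [ r ]≔ z j)
  term : (Fin (suc n) → Fin n → ℤ) → Fin (suc n) → ℤ
  term z j = sign (toℕ j) * (M zero j * D z j)
  distrib : ∀ a s m d e → s * (m * (a * d + e)) ≡ a * (s * (m * d)) + s * (m * e)
  distrib = solve-∀

record IsMultilinear {n} (f : Matrix n → ℤ) : Set where
  field
    ≋-cong : ∀ {M N} → M ≋ N → f M ≡ f N
    linear : ∀ M r a x y → f (M [ r ]≔ (λ j → a * x j + y j)) ≡ a * f (M [ r ]≔ x) + f (M [ r ]≔ y)

  additive : ∀ M r x y → f (M [ r ]≔ (λ j → x j + y j)) ≡ f (M [ r ]≔ x) + f (M [ r ]≔ y)
  additive M r x y = begin
    f (M [ r ]≔ (λ j → x j + y j))       ≡⟨ ≋-cong ([]≔-cong M r (λ j → cong (_+ y j) (sym (ℤ.*-identityˡ (x j))))) ⟩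
    f (M [ r ]≔ (λ j → 1ℤ * x j + y j))  ≡⟨ linear M r 1ℤ x y ⟩
    1ℤ * f (M [ r ]≔ x) + f (M [ r ]≔ y) ≡⟨ cong (_+ f (M [ r ]≔ y)) (ℤ.*-identityˡ (f (M [ r ]≔ x))) ⟩
    f (M [ r ]≔ x) + f (M [ r ]≔ y)      ∎
    where open ≡-Reasoning

  zero-row : ∀ M r → (∀ j → M r j ≡ 0ℤ) → f M ≡ 0ℤ
  zero-row M r Mr≗0 = trans (sym (≋-cong ([]≔-self M r (sym ∘ Mr≗0)))) (identityˡ-unique D D (sym D≡D+D))
    where
    D = f (M [ r ]≔ const 0ℤ)
    D≡D+D : D ≡ D + D
    D≡D+D = additive M r (const 0ℤ) (const 0ℤ)

  linear-sum : ∀ M r {p} (a : Fin p → ℤ) (x : Fin p → Fin n → ℤ) →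
    f (M [ r ]≔ (λ j → sumFin (λ c → a c * x c j))) ≡ sumFin (λ c → a c * f (M [ r ]≔ x c))
  linear-sum M r {zero}  a x = zero-row (M [ r ]≔ const 0ℤ) r ([]≔-updates M r)
  linear-sum M r {suc p} a x =
    trans (linear M r (a zero) (x zero) _) (cong (a zero * f (M [ r ]≔ x zero) +_) (linear-sum M r (a ∘ suc) (x ∘ suc)))

  expand-row : ∀ M r → f M ≡ sumFin (λ c → M r c * f (M [ r ]≔ δ c))
  expand-row M r = trans (sym (≋-cong ([]≔-self M r (λ j → sumFin-δʳ j (M r))))) (linear-sum M r (M r) δ)

record IsAlternatingMultilinear {n} (f : Matrix n → ℤ) : Set where
  field
    isMultilinear : IsMultilinear f
    alternating   : ∀ M {r s} → r ≢ s → (∀ j → M r j ≡ M s j) → f M ≡ 0ℤ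

  open IsMultilinear isMultilinear public

  add-combination : ∀ M r (c : Fin n → ℤ) → c r ≡ 0ℤ →
    f (M [ r ]≔ (λ j → M r j + sumFin (λ s → c s * M s j))) ≡ f M
  add-combination M r c cr≡0 = begin
    f (M [ r ]≔ (λ j → M r j + sumFin (λ s → c s * M s j)))  ≡⟨ additive M r (M r) _ ⟩
    f (M [ r ]≔ M r) + f (M [ r ]≔ (λ j → sumFin (λ s → c s * M s j)))
      ≡⟨ cong₂ _+_ (≋-cong ([]≔-self M r (λ _ → refl))) (trans (linear-sum M r c M) (sumFin-zero vanish)) ⟩
    f M + 0ℤ                                                 ≡⟨ ℤ.+-identityʳ (f M) ⟩
    f M                                                      ∎
    where
    open ≡-Reasoning
    vanish : ∀ s → c s * f (M [ r ]≔ M s) ≡ 0ℤ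
    vanish s with s Fin.≟ r
    ... | yes refl = cong (_* f (M [ s ]≔ M s)) cr≡0
    ... | no s≢r   = trans (cong (c s *_) (alternating (M [ r ]≔ M s) (s≢r ∘ sym)
                             (λ j → trans ([]≔-updates M r j) (sym ([]≔-minimal M r s≢r j)))))
                           (ℤ.*-zeroʳ (c s))

  swap : ∀ M {r s} → r ≢ s → ∀ x y → f ((M [ r ]≔ x) [ s ]≔ y) ≡ - f ((M [ r ]≔ y) [ s ]≔ x)
  swap M {r} {s} r≢s x y = inverseˡ-unique (G x y) (G y x) (begin
    G x y + G y x                          ≡⟨ sym (cong₂ _+_ (ℤ.+-identityˡ (G x y)) (ℤ.+-identityʳ (G y x))) ⟩
    (0ℤ + G x y) + (G y x + 0ℤ)            ≡⟨ sym (cong₂ _+_ (cong (_+ G x y) (G-diag x)) (cong (G y x +_) (G-diag y))) ⟩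
    (G x x + G x y) + (G y x + G y y)      ≡⟨ sym (cong₂ _+_ (G-additiveʳ x x y) (G-additiveʳ y x y)) ⟩
    G x x+y + G y x+y                      ≡⟨ sym (G-additiveˡ x y x+y) ⟩
    G x+y x+y                              ≡⟨ G-diag x+y ⟩
    0ℤ                                     ∎)
    where
    open ≡-Reasoning
    G : (Fin n → ℤ) → (Fin n → ℤ) → ℤ
    G x y = f ((M [ r ]≔ x) [ s ]≔ y)
    x+y : Fin n → ℤ
    x+y j = x j + y j
    commute : ∀ x y → (M [ r ]≔ x) [ s ]≔ y ≋ (M [ s ]≔ y) [ r ]≔ x
    commute x y i = cong-app (updateAt-commutes s r (r≢s ∘ sym) M i)
    G-additiveˡ : ∀ x x′ y → G (λ j → x j + x′ j) y ≡ G x y + G x′ y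
    G-additiveˡ x x′ y = begin
      G (λ j → x j + x′ j) y                     ≡⟨ ≋-cong (commute _ y) ⟩
      f ((M [ s ]≔ y) [ r ]≔ (λ j → x j + x′ j)) ≡⟨ additive (M [ s ]≔ y) r x x′ ⟩
      f ((M [ s ]≔ y) [ r ]≔ x) + f ((M [ s ]≔ y) [ r ]≔ x′)
        ≡⟨ sym (cong₂ _+_ (≋-cong (commute x y)) (≋-cong (commute x′ y))) ⟩
      G x y + G x′ y                             ∎
    G-additiveʳ : ∀ x y y′ → G x (λ j → y j + y′ j) ≡ G x y + G x y′
    G-additiveʳ x = additive (M [ r ]≔ x) s
    G-diag : ∀ z → G z z ≡ 0ℤ
    G-diag z = alternating _ r≢s (λ j →
      trans ([]≔-minimal (M [ r ]≔ z) s r≢s j) (trans ([]≔-updates M r j) (sym ([]≔-updates (M [ r ]≔ z) s j))))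

  -- The rows r with S r are changed one at a time, in index order (W t has those of index < t
  -- changed). The sources of the combinations are never changed, so each step is add-combination.
  row-operations : ∀ (P Q : Matrix n) (S : Fin n → Bool) (c : Fin n → Fin n → ℤ) →
    (∀ r → S r ≡ false → ∀ j → Q r j ≡ P r j) →
    (∀ r → S r ≡ true → ∀ j → Q r j ≡ P r j + sumFin (λ s → c r s * P s j)) →
    (∀ r s → S s ≡ true → c r s ≡ 0ℤ) →
    f Q ≡ f P
  row-operations P Q S c fixed changed unchanged-sources = trans (≋-cong Q≋W) (prefix n ℕ.≤-refl)
    where
    W : ℕ → Matrix n
    W t r = if toℕ r <ᵇ t then Q r else P r

    W-at : ∀ t {r b} → (toℕ r <ᵇ t) ≡ b → ∀ j → W t r j ≡ (if b then Q r else P r) j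
    W-at t {r} eq j = cong (λ b → (if b then Q r else P r) j) eq

    Q≋W : Q ≋ W n
    Q≋W r j = sym (W-at n (toℕ-<ᵇ r) j)

    W-fixed : ∀ t s → S s ≡ false → ∀ j → W t s j ≡ P s j
    W-fixed t s Ss j with toℕ s <ᵇ t
    ... | true  = fixed s Ss j
    ... | false = refl

    W-diag : ∀ r j → W (toℕ r) r j ≡ P r j
    W-diag r = W-at (toℕ r) (<ᵇ-irrefl (toℕ r))

    W-suc : ∀ r → W (suc (toℕ r)) ≋ W (toℕ r) [ r ]≔ Q r
    W-suc r₀ r j with r Fin.≟ r₀
    ... | yes refl = trans (W-at (suc (toℕ r)) (<ᵇ-suc-self (toℕ r)) j) (sym ([]≔-updates (W (toℕ r)) r j))
    ... | no r≢r₀  = trans (W-at (suc (toℕ r₀)) (<ᵇ-suc (r≢r₀ ∘ Fin.toℕ-injective)) j) (sym ([]≔-minimal (W (toℕ r₀)) r₀ r≢r₀ j))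

    step-at : ∀ r₀ → f (W (suc (toℕ r₀))) ≡ f (W (toℕ r₀))
    step-at r₀ with S r₀ in S-r₀
    ... | false = trans (≋-cong (W-suc r₀)) (≋-cong ([]≔-self (W t) r₀ (λ j → trans (fixed r₀ S-r₀ j) (sym (W-diag r₀ j)))))
      where t = toℕ r₀
    ... | true  = begin
      f (W (suc t))                                                      ≡⟨ ≋-cong (W-suc r₀) ⟩
      f (W t [ r₀ ]≔ Q r₀)                                               ≡⟨ ≋-cong ([]≔-cong (W t) r₀ Q-r₀) ⟩
      f (W t [ r₀ ]≔ (λ j → W t r₀ j + sumFin (λ s → c r₀ s * W t s j))) ≡⟨ add-combination (W t) r₀ (c r₀) (unchanged-sources r₀ r₀ S-r₀) ⟩
      f (W t)                                                            ∎
      where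
      open ≡-Reasoning
      t = toℕ r₀
      same-sources : ∀ j s → c r₀ s * P s j ≡ c r₀ s * W t s j
      same-sources j s with S s in S-s
      ... | true  = trans (cong (_* P s j) (unchanged-sources r₀ s S-s)) (sym (cong (_* W t s j) (unchanged-sources r₀ s S-s)))
      ... | false = cong (c r₀ s *_) (sym (W-fixed t s S-s j))
      Q-r₀ : ∀ j → Q r₀ j ≡ W t r₀ j + sumFin (λ s → c r₀ s * W t s j)
      Q-r₀ j = trans (changed r₀ S-r₀ j) (cong₂ _+_ (sym (W-diag r₀ j)) (sumFin-cong (same-sources j)))

    prefix : ∀ t → t ℕ.≤ n → f (W t) ≡ f P
    prefix zero    _   = refl
    prefix (suc t) t<n = trans step (prefix t (ℕ.<⇒≤ t<n))
      where
      step : f (W (suc t)) ≡ f (W t)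
      step = subst (λ t → f (W (suc t)) ≡ f (W t)) (Fin.toℕ-fromℕ< t<n) (step-at (Fin.fromℕ< t<n))

det-isMultilinear : ∀ {n} → IsMultilinear (det {n})
det-isMultilinear = record { ≋-cong = det-cong ; linear = det-linear }

-- punchIn-flip c l is the position of c once the index punchIn c l has been removed.
punchIn-flip : ∀ {n} → Fin (suc (suc n)) → Fin (suc n) → Fin (suc n)
punchIn-flip zero    l = zero
punchIn-flip (suc c) zero = c
punchIn-flip {suc n} (suc c) (suc l) = suc (punchIn-flip c l)

punchIn-punchIn-flip : ∀ {n} (c : Fin (suc (suc n))) l → punchIn (punchIn c l) (punchIn-flip c l) ≡ c
punchIn-punchIn-flip zero    l    = refl
punchIn-punchIn-flip (suc c) zero = refl
punchIn-punchIn-flip {suc n} (suc c) (suc l) = cong suc (punchIn-punchIn-flip c l)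

punchIn-punchIn : ∀ {n} (c : Fin (suc (suc n))) l b →
  punchIn c (punchIn l b) ≡ punchIn (punchIn c l) (punchIn (punchIn-flip c l) b)
punchIn-punchIn zero    l    b = refl
punchIn-punchIn (suc c) zero b = refl
punchIn-punchIn {suc n} (suc c) (suc l) zero    = refl
punchIn-punchIn {suc n} (suc c) (suc l) (suc b) = cong suc (punchIn-punchIn c l b)

sign-punchIn-flip : ∀ {n} (c : Fin (suc (suc n))) l →
  sign (toℕ (punchIn c l) ℕ.+ toℕ (punchIn-flip c l)) ≡ - sign (toℕ c ℕ.+ toℕ l)
sign-punchIn-flip zero    l    rewrite ℕ.+-identityʳ (toℕ l) = refl
sign-punchIn-flip (suc c) zero rewrite ℕ.+-identityʳ (toℕ c) = sym (ℤ.neg-involutive _)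
sign-punchIn-flip {suc n} (suc c) (suc l) =
  trans (sign-suc-suc (toℕ (punchIn c l)) (toℕ (punchIn-flip c l)))
        (trans (sign-punchIn-flip c l) (cong -_ (sym (sign-suc-suc (toℕ c) (toℕ l)))))

δ-punchIn-flip : ∀ {n} (c : Fin (suc (suc n))) l b → δ c (punchIn (punchIn c l) b) ≡ δ (punchIn-flip c l) b
δ-punchIn-flip c l b =
  trans (cong (λ c′ → δ c′ (punchIn (punchIn c l) b)) (sym (punchIn-punchIn-flip c l)))
        (δ-injective (Fin.punchIn-injective (punchIn c l) _ _) (punchIn-flip c l) b)

sign-minor-minor : ∀ {n} (r : ℕ) (c : Fin (suc (suc n))) l →
  sign (toℕ (punchIn c l)) * sign (r ℕ.+ toℕ (punchIn-flip c l)) ≡ sign (suc r ℕ.+ toℕ c) * sign (toℕ l)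
sign-minor-minor r c l = begin
  sⱼ * sign (r ℕ.+ toℕ k)  ≡⟨ cong (sⱼ *_) (sign-+ r (toℕ k)) ⟩
  sⱼ * (sign r * sₖ)        ≡⟨ left-swap sⱼ (sign r) sₖ ⟩
  sign r * (sⱼ * sₖ)        ≡⟨ cong (sign r *_) (trans (sym (sign-+ (toℕ j) (toℕ k))) (sign-punchIn-flip c l)) ⟩
  sign r * - sign (toℕ c ℕ.+ toℕ l)       ≡⟨ cong (λ x → sign r * - x) (sign-+ (toℕ c) (toℕ l)) ⟩
  sign r * - (sign (toℕ c) * sign (toℕ l)) ≡⟨ regroup (sign r) (sign (toℕ c)) (sign (toℕ l)) ⟩
  - (sign r * sign (toℕ c)) * sign (toℕ l) ≡⟨ cong (λ x → - x * sign (toℕ l)) (sym (sign-+ r (toℕ c))) ⟩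
  sign (suc r ℕ.+ toℕ c) * sign (toℕ l)   ∎
  where
  open ≡-Reasoning
  j = punchIn c l
  k = punchIn-flip c l
  sⱼ = sign (toℕ j)
  sₖ = sign (toℕ k)
  left-swap : ∀ a b c → a * (b * c) ≡ b * (a * c)
  left-swap = solve-∀
  regroup : ∀ a b c → a * - (b * c) ≡ - (a * b) * c
  regroup = solve-∀

det-[]≔δ : ∀ {n} (M : Matrix (suc n)) r c → det (M [ r ]≔ δ c) ≡ sign (toℕ r ℕ.+ toℕ c) * det (minor M r c)
det-[]≔δ M zero c =
  trans (sumFin-cong (λ j → left-swap (sign (toℕ j)) (δ c j) (det (minor M zero j))))
        (sumFin-δ c (λ j → sign (toℕ j) * det (minor M zero j)))
  where
  left-swap : ∀ a b c → a * (b * c) ≡ b * (a * c)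
  left-swap = solve-∀
det-[]≔δ {suc n} M (suc r) c = begin
  det (M [ suc r ]≔ δ c)                          ≡⟨ det-[suc]≔ M r (δ c) ⟩
  sumFin summand                                        ≡⟨ sumFin-punchIn c summand ⟩
  summand c + sumFin (summand ∘ punchIn c)                    ≡⟨ cong₂ _+_ summand-c (sumFin-cong summand-punchIn) ⟩
  0ℤ + sumFin (λ l → s * term l)              ≡⟨ ℤ.+-identityˡ _ ⟩
  sumFin (λ l → s * term l)                   ≡⟨ sumFin-*ˡ s term ⟩
  s * det (minor M (suc r) c)                     ∎
  where
  open ≡-Reasoning
  open IsMultilinear det-isMultilinear using (zero-row)
  s = sign (suc (toℕ r) ℕ.+ toℕ c)
  summand : Fin (suc (suc n)) → ℤ
  summand j = sign (toℕ j) * (M zero j * det (minor M zero j [ r ]≔ (δ c ∘ punchIn j)))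
  term : Fin (suc n) → ℤ
  term l = sign (toℕ l) * (M zero (punchIn c l) * det (minor (minor M (suc r) c) zero l))
  summand-c : summand c ≡ 0ℤ
  summand-c = trans (cong (λ d → sign (toℕ c) * (M zero c * d))
                    (zero-row (minor M zero c [ r ]≔ (δ c ∘ punchIn c)) r
                              (λ b → trans ([]≔-updates (minor M zero c) r b) (δ-punchIn c b))))
              (trans (cong (sign (toℕ c) *_) (ℤ.*-zeroʳ (M zero c))) (ℤ.*-zeroʳ (sign (toℕ c))))
  summand-punchIn : ∀ l → summand (punchIn c l) ≡ s * term l
  summand-punchIn l = begin
    sⱼ * (M zero j * det (minor M zero j [ r ]≔ (δ c ∘ punchIn j)))
      ≡⟨ cong (λ d → sⱼ * (M zero j * d)) (trans (det-cong ([]≔-cong (minor M zero j) r (δ-punchIn-flip c l)))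
                                                  (det-[]≔δ (minor M zero j) r k)) ⟩
    sⱼ * (M zero j * (sign (toℕ r ℕ.+ toℕ k) * det (minor (minor M zero j) r k)))
      ≡⟨ cong (λ d → sⱼ * (M zero j * (sign (toℕ r ℕ.+ toℕ k) * d)))
              (det-cong (λ a b → cong (M (suc (punchIn r a))) (sym (punchIn-punchIn c l b)))) ⟩
    sⱼ * (M zero j * (sign (toℕ r ℕ.+ toℕ k) * D))
      ≡⟨ regroup sⱼ (M zero j) (sign (toℕ r ℕ.+ toℕ k)) D ⟩
    (sⱼ * sign (toℕ r ℕ.+ toℕ k)) * (M zero j * D)
      ≡⟨ cong (_* (M zero j * D)) (sign-minor-minor (toℕ r) c l) ⟩
    (s * sign (toℕ l)) * (M zero j * D)
      ≡⟨ ℤ.*-assoc s (sign (toℕ l)) (M zero j * D) ⟩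
    s * term l                                   ∎
    where
    j = punchIn c l
    k = punchIn-flip c l
    sⱼ = sign (toℕ j)
    D = det (minor (minor M (suc r) c) zero l)
    regroup : ∀ a b c d → a * (b * (c * d)) ≡ (a * c) * (b * d)
    regroup = solve-∀

det-expand-row : ∀ {n} (M : Matrix (suc n)) r →
  det M ≡ sumFin (λ c → M r c * (sign (toℕ r ℕ.+ toℕ c) * det (minor M r c)))
det-expand-row M r =
  trans (IsMultilinear.expand-row det-isMultilinear M r) (sumFin-cong (λ c → cong (M r c *_) (det-[]≔δ M r c)))

det-2×2 : (M : Matrix 2) → det M ≡ M zero zero * M (suc zero) (suc zero) - M zero (suc zero) * M (suc zero) zero
det-2×2 M = expand (M zero zero) (M zero (suc zero)) (M (suc zero) zero) (M (suc zero) (suc zero))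
  where
  -- det unfolded on a 2 × 2 matrix
  expand : ∀ a b c d → 1ℤ * (a * (1ℤ * (d * 1ℤ) + 0ℤ)) + (- 1ℤ * (b * (1ℤ * (c * 1ℤ) + 0ℤ)) + 0ℤ) ≡ a * d - b * c
  expand = solve-∀

commutator : ∀ a b → a * b - b * a ≡ 0ℤ
commutator = solve-∀

third-row : ∀ {n} (r s : Fin (suc (suc (suc n)))) → Σ[ t ∈ Fin (suc (suc (suc n))) ] t ≢ r × t ≢ s
third-row (suc r)       (suc s)       = zero , (λ ()) , (λ ())
third-row zero          zero          = suc zero , (λ ()) , (λ ())
third-row zero          (suc zero)    = suc (suc zero) , (λ ()) , (λ ())
third-row zero          (suc (suc s)) = suc zero , (λ ()) , (λ ())
third-row (suc zero)    zero          = suc (suc zero) , (λ ()) , (λ ())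
third-row (suc (suc r)) zero          = suc zero , (λ ()) , (λ ())

-- For n ≥ 3, expand along a row t ∉ {r, s}: every minor M t c still has two equal rows.
det-alternating : ∀ {n} (M : Matrix n) {r s} → r ≢ s → (∀ j → M r j ≡ M s j) → det M ≡ 0ℤ
det-alternating {1} M {zero} {zero} r≢s _ = contradiction refl r≢s
det-alternating {2} M {zero} {zero} r≢s _ = contradiction refl r≢s
det-alternating {2} M {suc zero} {suc zero} r≢s _ = contradiction refl r≢s
det-alternating {2} M {zero} {suc zero} _ M₀≗M₁ =
  trans (det-2×2 M) (trans (cong₂ (λ x y → M zero zero * x - M zero (suc zero) * y) (sym (M₀≗M₁ (suc zero))) (sym (M₀≗M₁ zero)))
                           (commutator (M zero zero) (M zero (suc zero))))
det-alternating {2} M {suc zero} {zero} r≢s M₁≗M₀ = det-alternating M (r≢s ∘ sym) (sym ∘ M₁≗M₀)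
det-alternating {suc (suc (suc n))} M {r} {s} r≢s Mr≗Ms =
  trans (det-expand-row M t) (sumFin-zero (λ c →
    trans (cong (λ d → M t c * (sign (toℕ t ℕ.+ toℕ c) * d)) (det-alternating {suc (suc n)} (minor M t c) r′≢s′ (equal-rows c)))
          (trans (cong (M t c *_) (ℤ.*-zeroʳ (sign (toℕ t ℕ.+ toℕ c)))) (ℤ.*-zeroʳ (M t c)))))
  where
  t : Fin (suc (suc (suc n)))
  t = proj₁ (third-row r s)
  t≢r : t ≢ r
  t≢r = proj₁ (proj₂ (third-row r s))
  t≢s : t ≢ s
  t≢s = proj₂ (proj₂ (third-row r s))
  r′ s′ : Fin (suc (suc n))
  r′ = punchOut t≢r
  s′ = punchOut t≢s
  r′≢s′ : r′ ≢ s′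
  r′≢s′ r′≡s′ = r≢s (trans (sym (Fin.punchIn-punchOut t≢r)) (trans (cong (punchIn t) r′≡s′) (Fin.punchIn-punchOut t≢s)))
  equal-rows : ∀ c j → minor M t c r′ j ≡ minor M t c s′ j
  equal-rows c j =
    trans (cong (λ i → M i (punchIn c j)) (Fin.punchIn-punchOut t≢r))
          (trans (Mr≗Ms (punchIn c j)) (cong (λ i → M i (punchIn c j)) (sym (Fin.punchIn-punchOut t≢s))))

det-isAlternatingMultilinear : ∀ {n} → IsAlternatingMultilinear (det {n})
det-isAlternatingMultilinear = record { isMultilinear = det-isMultilinear ; alternating = det-alternating }

det-[]≔row : ∀ {n} (M : Matrix n) v b → det (M [ v ]≔ M b) ≡ δ b v * det M
det-[]≔row M v b with b Fin.≟ v
... | yes refl = trans (det-cong ([]≔-self M b (λ _ → refl))) (sym (ℤ.*-identityˡ (det M)))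
... | no b≢v   = det-alternating (M [ v ]≔ M b) (b≢v ∘ sym)
                   (λ j → trans ([]≔-updates M v j) (sym ([]≔-minimal M v b≢v j)))

det-cofactor-expansion : ∀ {n} (M : Matrix n) v b → sumFin (λ a → M b a * det (M [ v ]≔ δ a)) ≡ δ b v * det M
det-cofactor-expansion M v b = begin
  sumFin (λ a → M b a * det (M [ v ]≔ δ a))
    ≡⟨ sumFin-cong (λ a → cong₂ _*_ (sym ([]≔-updates M v a)) (sym (det-cong ([]≔-idem M v (M b) (δ a))))) ⟩
  sumFin (λ a → (M [ v ]≔ M b) v a * det ((M [ v ]≔ M b) [ v ]≔ δ a))
    ≡⟨ sym (IsMultilinear.expand-row det-isMultilinear (M [ v ]≔ M b) v) ⟩
  det (M [ v ]≔ M b)                                                     ≡⟨ det-[]≔row M v b ⟩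
  δ b v * det M                                                          ∎
  where open ≡-Reasoning

det-[]≔δ-diag : ∀ {n} (M : Matrix (suc n)) v → det (M [ v ]≔ δ v) ≡ det (minor M v v)
det-[]≔δ-diag M v =
  trans (det-[]≔δ M v v)
        (trans (cong (_* det (minor M v v)) (trans (sign-+ (toℕ v) (toℕ v)) (sign-*-self (toℕ v))))
               (ℤ.*-identityˡ (det (minor M v v))))

-- Alternating multilinear forms are multiples of the determinant

identity : ∀ {n} → Matrix n
identity = δ

punchIn-cases : ∀ {n} {P : Fin (suc n) → Set} (c : Fin (suc n)) → P c → (∀ l → P (punchIn c l)) → ∀ j → P j
punchIn-cases {P = P} c P-c P-punchIn j with c Fin.≟ j
... | yes refl = P-c
... | no c≢j   = subst P (Fin.punchIn-punchOut c≢j) (P-punchIn (punchOut c≢j))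

module _ {n : ℕ} (c : Fin (suc n)) where

  insertAt-cong : ∀ {x y : Fin n → ℤ} → (∀ i → x i ≡ y i) → ∀ j → insertAt x c 0ℤ j ≡ insertAt y c 0ℤ j
  insertAt-cong {x} {y} x≗y = punchIn-cases c
    (trans (insertAt-lookup x c 0ℤ) (sym (insertAt-lookup y c 0ℤ)))
    (λ l → trans (insertAt-punchIn x c 0ℤ l) (trans (x≗y l) (sym (insertAt-punchIn y c 0ℤ l))))

  insertAt-zero : ∀ j → insertAt (const 0ℤ) c 0ℤ j ≡ 0ℤ
  insertAt-zero = punchIn-cases c (insertAt-lookup (const 0ℤ) c 0ℤ) (insertAt-punchIn (const 0ℤ) c 0ℤ)

  insertAt-linear : ∀ a (x y : Fin n → ℤ) j →
    insertAt (λ i → a * x i + y i) c 0ℤ j ≡ a * insertAt x c 0ℤ j + insertAt y c 0ℤ j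
  insertAt-linear a x y = punchIn-cases c
    (trans (insertAt-lookup _ c 0ℤ)
           (sym (trans (cong₂ (λ s t → a * s + t) (insertAt-lookup x c 0ℤ) (insertAt-lookup y c 0ℤ))
                       (trans (ℤ.+-identityʳ (a * 0ℤ)) (ℤ.*-zeroʳ a)))))
    (λ l → trans (insertAt-punchIn _ c 0ℤ l)
                 (sym (cong₂ (λ s t → a * s + t) (insertAt-punchIn x c 0ℤ l) (insertAt-punchIn y c 0ℤ l))))

  insertAt-split : ∀ (g : Fin (suc n) → ℤ) j → g j ≡ insertAt (g ∘ punchIn c) c 0ℤ j + g c * δ c j
  insertAt-split g = punchIn-cases c
    (sym (trans (cong₂ _+_ (insertAt-lookup (g ∘ punchIn c) c 0ℤ) (cong (g c *_) (δ-refl c)))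
                (trans (ℤ.+-identityˡ (g c * 1ℤ)) (ℤ.*-identityʳ (g c)))))
    (λ l → sym (trans (cong₂ _+_ (insertAt-punchIn (g ∘ punchIn c) c 0ℤ l) (cong (g c *_) (δ-punchIn c l)))
                      (trans (cong (g (punchIn c l) +_) (ℤ.*-zeroʳ (g c))) (ℤ.+-identityʳ (g (punchIn c l))))))

extend : ∀ {m} → Fin (suc m) → Matrix m → Matrix (suc m)
extend c Z zero    = δ c
extend c Z (suc i) = insertAt (Z i) c 0ℤ

extend-[]≔ : ∀ {m} c (Z : Matrix m) r w → extend c (Z [ r ]≔ w) ≋ extend c Z [ suc r ]≔ insertAt w c 0ℤ
extend-[]≔ c Z r w zero    j = refl
extend-[]≔ c Z r w (suc i) j = cong-app (map-updateAt {f = λ z → insertAt z c 0ℤ} (λ _ → refl) Z r i) j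

extend-zero-identity : ∀ {m} → extend zero (identity {m}) ≋ identity
extend-zero-identity zero    j       = refl
extend-zero-identity (suc i) zero    = refl
extend-zero-identity (suc i) (suc j) = sym (δ-suc i j)

det-extend : ∀ {m} c (Z : Matrix m) → det (extend c Z) ≡ sign (toℕ c) * det Z
det-extend c Z = trans (det-[]≔δ (extend c Z) zero c) (cong (sign (toℕ c) *_) (det-cong (λ i → insertAt-punchIn (Z i) c 0ℤ)))

det-identity : ∀ {n} → det (identity {n}) ≡ 1ℤ
det-identity {zero}  = refl
det-identity {suc n} =
  trans (sym (det-cong (extend-zero-identity {n})))
        (trans (det-extend zero (identity {n})) (trans (ℤ.*-identityˡ (det (identity {n}))) (det-identity {n})))

module _ {m} {f : Matrix (suc m) → ℤ} (isAM : IsAlternatingMultilinear f) where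
  open IsAlternatingMultilinear isAM

  extend-isAlternatingMultilinear : ∀ c → IsAlternatingMultilinear (f ∘ extend c)
  extend-isAlternatingMultilinear c = record
    { isMultilinear = record
      { ≋-cong = λ Z≋Z′ → ≋-cong (λ { zero j → refl ; (suc i) j → insertAt-cong c (Z≋Z′ i) j })
      ; linear = linear-extend
      }
    ; alternating = λ Z r≢s Zr≗Zs → alternating (extend c Z) (r≢s ∘ Fin.suc-injective) (insertAt-cong c Zr≗Zs)
    }
    where
    linear-extend : ∀ Z r a x y →
      f (extend c (Z [ r ]≔ (λ j → a * x j + y j))) ≡ a * f (extend c (Z [ r ]≔ x)) + f (extend c (Z [ r ]≔ y))
    linear-extend Z r a x y = begin
      f (extend c (Z [ r ]≔ (λ j → a * x j + y j)))
        ≡⟨ ≋-cong (extend-[]≔ c Z r _) ⟩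
      f (extend c Z [ suc r ]≔ insertAt (λ j → a * x j + y j) c 0ℤ)
        ≡⟨ ≋-cong ([]≔-cong (extend c Z) (suc r) (insertAt-linear c a x y)) ⟩
      f (extend c Z [ suc r ]≔ (λ j → a * insertAt x c 0ℤ j + insertAt y c 0ℤ j))
        ≡⟨ linear (extend c Z) (suc r) a _ _ ⟩
      a * f (extend c Z [ suc r ]≔ insertAt x c 0ℤ) + f (extend c Z [ suc r ]≔ insertAt y c 0ℤ)
        ≡⟨ sym (cong₂ (λ s t → a * s + t) (≋-cong (extend-[]≔ c Z r x)) (≋-cong (extend-[]≔ c Z r y))) ⟩
      a * f (extend c (Z [ r ]≔ x)) + f (extend c (Z [ r ]≔ y))
        ∎
      where open ≡-Reasoning

  []≔δ-extend : ∀ Y c → f (Y [ zero ]≔ δ c) ≡ f (extend c (minor Y zero c))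
  []≔δ-extend Y c = row-operations P (Y [ zero ]≔ δ c) S coefficient fixed changed unchanged-sources
    where
    P : Matrix (suc m)
    P = extend c (minor Y zero c)
    S : Fin (suc m) → Bool
    S zero    = false
    S (suc _) = true
    coefficient : Fin (suc m) → Fin (suc m) → ℤ
    coefficient (suc i) zero = Y (suc i) c
    coefficient _       _    = 0ℤ
    fixed : ∀ r → S r ≡ false → ∀ j → (Y [ zero ]≔ δ c) r j ≡ P r j
    fixed zero _ j = refl
    changed : ∀ r → S r ≡ true → ∀ j → (Y [ zero ]≔ δ c) r j ≡ P r j + sumFin (λ s → coefficient r s * P s j)
    changed (suc i) _ j =
      trans (insertAt-split c (Y (suc i)) j)
            (cong (P (suc i) j +_) (sym (trans (cong (Y (suc i) c * δ c j +_) (sumFin-zero {m} (λ _ → refl)))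
                                               (ℤ.+-identityʳ (Y (suc i) c * δ c j)))))
    unchanged-sources : ∀ r s → S s ≡ true → coefficient r s ≡ 0ℤ
    unchanged-sources zero    (suc s) _ = refl
    unchanged-sources (suc r) (suc s) _ = refl

swap-extend : ∀ {m} (c : Fin (suc m)) →
  let M = extend (suc c) identity in (M [ zero ]≔ M (suc zero)) [ suc zero ]≔ M zero ≋ extend zero (extend c identity)
swap-extend c zero             zero    = refl
swap-extend c zero             (suc j) = insertAt-zero c j
swap-extend c (suc zero)       zero    = refl
swap-extend c (suc zero)       (suc j) = δ-suc c j
swap-extend c (suc (suc i))    zero    = refl
swap-extend c (suc (suc i))    (suc j) = insertAt-cong c (δ-suc i) j

DeterminedByDet : ℕ → Set
DeterminedByDet n = ∀ {g : Matrix n → ℤ} → IsAlternatingMultilinear g → ∀ Z → g Z ≡ det Z * g identity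

extend-identity : ∀ {m} {f : Matrix (suc m) → ℤ} → IsAlternatingMultilinear f → DeterminedByDet m →
  ∀ c → f (extend c identity) ≡ sign (toℕ c) * f identity
extend-identity isAM _ zero =
  trans (IsAlternatingMultilinear.≋-cong isAM extend-zero-identity) (sym (ℤ.*-identityˡ _))
extend-identity {suc m} {f} isAM determined (suc c) = begin
  f M                                                        ≡⟨ ≋-cong unswap ⟩
  f ((M [ zero ]≔ M zero) [ suc zero ]≔ M (suc zero))        ≡⟨ swap M {zero} {suc zero} (λ ()) (M zero) (M (suc zero)) ⟩
  - f ((M [ zero ]≔ M (suc zero)) [ suc zero ]≔ M zero)      ≡⟨ cong -_ (≋-cong (swap-extend c)) ⟩
  - f (extend zero (extend c identity))
    ≡⟨ cong -_ (determined (extend-isAlternatingMultilinear isAM zero) (extend c identity)) ⟩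
  - (det (extend c identity) * f (extend zero identity))
    ≡⟨ cong₂ (λ d e → - (d * e)) (trans (det-extend c identity) (trans (cong (sign (toℕ c) *_) (det-identity {m})) (ℤ.*-identityʳ (sign (toℕ c)))))
                                 (≋-cong extend-zero-identity) ⟩
  - (sign (toℕ c) * f identity)                              ≡⟨ ℤ.neg-distribˡ-* (sign (toℕ c)) (f identity) ⟩
  sign (toℕ (suc c)) * f identity                           ∎
  where
  open ≡-Reasoning
  open IsAlternatingMultilinear isAM
  M : Matrix (suc (suc m))
  M = extend (suc c) identity
  unswap : M ≋ (M [ zero ]≔ M zero) [ suc zero ]≔ M (suc zero)
  unswap zero          j = refl
  unswap (suc zero)    j = refl
  unswap (suc (suc i)) j = refl

-- Expand f along row 0. Clearing column c below the row δ c turns Y [ 0 ]≔ δ c into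
-- extend c (minor Y 0 c), and f ∘ extend c is alternating multilinear of size m.
alternatingMultilinear-det : ∀ {n} → DeterminedByDet n
alternatingMultilinear-det {zero}  isAM Y =
  trans (IsAlternatingMultilinear.≋-cong isAM (λ ())) (sym (ℤ.*-identityˡ _))
alternatingMultilinear-det {suc m} {f} isAM Y = begin
  f Y                                                                      ≡⟨ expand-row Y zero ⟩
  sumFin (λ c → Y zero c * f (Y [ zero ]≔ δ c))                            ≡⟨ sumFin-cong pivot ⟩
  sumFin (λ c → (sign (toℕ c) * (Y zero c * det (minor Y zero c))) * f identity) ≡⟨ sumFin-*ʳ (f identity) (λ c → sign (toℕ c) * (Y zero c * det (minor Y zero c))) ⟩
  det Y * f identity                                                       ∎
  where
  open ≡-Reasoning
  open IsAlternatingMultilinear isAM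
  pivot : ∀ c → Y zero c * f (Y [ zero ]≔ δ c) ≡ (sign (toℕ c) * (Y zero c * det (minor Y zero c))) * f identity
  pivot c = begin
    Y zero c * f (Y [ zero ]≔ δ c)                       ≡⟨ cong (Y zero c *_) ([]≔δ-extend isAM Y c) ⟩
    Y zero c * f (extend c (minor Y zero c))
      ≡⟨ cong (Y zero c *_) (alternatingMultilinear-det (extend-isAlternatingMultilinear isAM c) (minor Y zero c)) ⟩
    Y zero c * (det (minor Y zero c) * f (extend c identity))
      ≡⟨ cong (λ e → Y zero c * (det (minor Y zero c) * e)) (extend-identity isAM alternatingMultilinear-det c) ⟩
    Y zero c * (det (minor Y zero c) * (sign (toℕ c) * f identity))
      ≡⟨ regroup (Y zero c) (det (minor Y zero c)) (sign (toℕ c)) (f identity) ⟩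
    (sign (toℕ c) * (Y zero c * det (minor Y zero c))) * f identity ∎
    where
    regroup : ∀ y d s x → y * (d * (s * x)) ≡ (s * (y * d)) * x
    regroup = solve-∀

-- Block matrices

punchIn-↑ˡ : ∀ {p} q (j : Fin (suc p)) (b : Fin p) → punchIn (j ↑ˡ q) (b ↑ˡ q) ≡ punchIn j b ↑ˡ q
punchIn-↑ˡ q zero    b       = refl
punchIn-↑ˡ q (suc j) zero    = refl
punchIn-↑ˡ q (suc j) (suc b) = cong suc (punchIn-↑ˡ q j b)

punchIn-↑ʳ : ∀ {p} q (j : Fin (suc p)) (b : Fin q) → punchIn (j ↑ˡ q) (p ↑ʳ b) ≡ suc p ↑ʳ b
punchIn-↑ʳ q zero    b = refl
punchIn-↑ʳ {suc p} q (suc j) b = cong suc (punchIn-↑ʳ q j b)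

det-blockTriangular : ∀ p {q} (M : Matrix (p ℕ.+ q)) → (∀ i j → M (i ↑ˡ q) (p ↑ʳ j) ≡ 0ℤ) →
  det M ≡ det (λ i j → M (i ↑ˡ q) (j ↑ˡ q)) * det (λ i j → M (p ↑ʳ i) (p ↑ʳ j))
det-blockTriangular zero    M _ = sym (ℤ.*-identityˡ (det M))
det-blockTriangular (suc p) {q} M upper≡0 = begin
  det M                                                   ≡⟨ sumFin-↑ (suc p) summand ⟩
  sumFin (λ j → summand (j ↑ˡ q)) + sumFin (λ j → summand (suc p ↑ʳ j)) ≡⟨ cong₂ _+_ (sumFin-cong summand-left) (sumFin-zero summand-right) ⟩
  sumFin (λ j → term j * det BR) + 0ℤ                  ≡⟨ ℤ.+-identityʳ _ ⟩
  sumFin (λ j → term j * det BR)                       ≡⟨ sumFin-*ʳ (det BR) term ⟩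
  det TL * det BR                                          ∎
  where
  open ≡-Reasoning
  TL : Matrix (suc p)
  TL i j = M (i ↑ˡ q) (j ↑ˡ q)
  BR : Matrix q
  BR i j = M (suc p ↑ʳ i) (suc p ↑ʳ j)
  summand : Fin (suc (p ℕ.+ q)) → ℤ
  summand j = sign (toℕ j) * (M zero j * det (minor M zero j))
  term : Fin (suc p) → ℤ
  term j = sign (toℕ j) * (TL zero j * det (minor TL zero j))
  summand-right : ∀ j → summand (suc p ↑ʳ j) ≡ 0ℤ
  summand-right j = trans (cong (λ a → sign (toℕ (suc p ↑ʳ j)) * (a * det (minor M zero (suc p ↑ʳ j)))) (upper≡0 zero j))
                    (ℤ.*-zeroʳ (sign (toℕ (suc p ↑ʳ j))))
  minor-blocks : ∀ j → det (minor M zero (j ↑ˡ q)) ≡ det (minor TL zero j) * det BR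
  minor-blocks j = trans (det-blockTriangular p (minor M zero (j ↑ˡ q))
                           (λ a b → trans (cong (M (suc (a ↑ˡ q))) (punchIn-↑ʳ q j b)) (upper≡0 (suc a) b)))
                         (cong₂ _*_ (det-cong (λ a b → cong (M (suc (a ↑ˡ q))) (punchIn-↑ˡ q j b)))
                                    (det-cong (λ a b → cong (M (suc (p ↑ʳ a))) (punchIn-↑ʳ q j b))))
  summand-left : ∀ j → summand (j ↑ˡ q) ≡ term j * det BR
  summand-left j = trans (cong₂ (λ s d → sign s * (TL zero j * d)) (Fin.toℕ-↑ˡ j q) (minor-blocks j))
                   (regroup (sign (toℕ j)) (TL zero j) (det (minor TL zero j)) (det BR))
    where
    regroup : ∀ s a d e → s * (a * (d * e)) ≡ (s * (a * d)) * e
    regroup = solve-∀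

sumFin-combine : ∀ n k (f : Fin (n ℕ.* k) → ℤ) → sumFin f ≡ sumFin (λ i → sumFin (λ a → f (combine {n} {k} i a)))
sumFin-combine zero    k f = refl
sumFin-combine (suc n) k f =
  trans (sumFin-↑ k f) (cong (sumFin (λ a → f (a ↑ˡ (n ℕ.* k))) +_) (sumFin-combine n k (λ y → f (k ↑ʳ y))))

module Blocks (n k : ℕ) where

  outer : Fin (n ℕ.* k) → Fin n
  outer x = proj₁ (remQuot {n} k x)

  inner : Fin (n ℕ.* k) → Fin k
  inner x = proj₂ (remQuot {n} k x)

  outer-combine : ∀ i a → outer (combine i a) ≡ i
  outer-combine i a = cong proj₁ (Fin.remQuot-combine i a)

  inner-combine : ∀ (i : Fin n) a → inner (combine i a) ≡ a
  inner-combine i a = cong proj₂ (Fin.remQuot-combine i a)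

  combine-outer-inner : ∀ x → combine (outer x) (inner x) ≡ x
  combine-outer-inner = Fin.combine-remQuot {n} k

  sumFin-blocks : ∀ (γ : Fin n → Fin k → ℤ) → sumFin (λ s → γ (outer s) (inner s)) ≡ sumFin (λ j → sumFin (λ a → γ j a))
  sumFin-blocks γ = trans (sumFin-combine n k _) (sumFin-cong (λ j → sumFin-cong (λ a →
    cong (λ p → γ (proj₁ p) (proj₂ p)) (Fin.remQuot-combine j a))))

  blockMatrix : (Fin n → Fin k → Fin n → Fin k → ℤ) → Matrix (n ℕ.* k)
  blockMatrix F x y = F (outer x) (inner x) (outer y) (inner y)

  blockMatrix-at : ∀ F {x y i a j b} → remQuot {n} k x ≡ (i , a) → remQuot {n} k y ≡ (j , b) → blockMatrix F x y ≡ F i a j b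
  blockMatrix-at F = cong₂ (λ p q → F (proj₁ p) (proj₂ p) (proj₁ q) (proj₂ q))

  blockDiagonal : Matrix k → Matrix (n ℕ.* k)
  blockDiagonal C = blockMatrix (λ i a j b → δ i j * C a b)

det-blockDiagonal : ∀ n k (C : Matrix k) → det (Blocks.blockDiagonal n k C) ≡ det C ^ n
det-blockDiagonal zero    k C = refl
det-blockDiagonal (suc n) k C = begin
  det (blockDiagonal C)
    ≡⟨ det-blockTriangular k (blockDiagonal C) (λ a y → blockMatrix-at diagonal (top a) (bottom y)) ⟩
  det (λ a b → blockDiagonal C (a ↑ˡ (n ℕ.* k)) (b ↑ˡ (n ℕ.* k))) * det (λ x y → blockDiagonal C (k ↑ʳ x) (k ↑ʳ y))
    ≡⟨ cong₂ _*_ (det-cong (λ a b → trans (blockMatrix-at diagonal (top a) (top b)) (ℤ.*-identityˡ (C a b))))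
                 (det-cong (λ x y → trans (blockMatrix-at diagonal (bottom x) (bottom y))
                                          (cong (_* C (Below.inner x) (Below.inner y)) (δ-suc (Below.outer x) (Below.outer y))))) ⟩
  det C * det (Below.blockDiagonal C)  ≡⟨ cong (det C *_) (det-blockDiagonal n k C) ⟩
  det C * det C ^ n                    ∎
  where
  open ≡-Reasoning
  open Blocks (suc n) k
  module Below = Blocks n k
  diagonal : Fin (suc n) → Fin k → Fin (suc n) → Fin k → ℤ
  diagonal i a j b = δ i j * C a b
  top : ∀ a → remQuot {suc n} k (a ↑ˡ (n ℕ.* k)) ≡ (zero , a)
  top = Fin.remQuot-combine zero
  bottom : ∀ x → remQuot {suc n} k (k ↑ʳ x) ≡ (suc (Below.outer x) , Below.inner x)
  bottom x rewrite Fin.splitAt-↑ʳ k (n ℕ.* k) x = refl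

-- Rooted products

IsUnitDet-* : ∀ {a b} → IsUnitDet a → IsUnitDet b → IsUnitDet (a * b)
IsUnitDet-* (inj₁ refl) (inj₁ refl) = inj₁ refl
IsUnitDet-* (inj₁ refl) (inj₂ refl) = inj₂ refl
IsUnitDet-* (inj₂ refl) (inj₁ refl) = inj₂ refl
IsUnitDet-* (inj₂ refl) (inj₂ refl) = inj₁ refl

IsUnitDet-^ : ∀ {a} → IsUnitDet a → ∀ n → IsUnitDet (a ^ n)
IsUnitDet-^ unit zero    = inj₁ refl
IsUnitDet-^ unit (suc n) = IsUnitDet-* unit (IsUnitDet-^ unit n)

IsUnitDet⇒*-self : ∀ {a} → IsUnitDet a → a * a ≡ 1ℤ
IsUnitDet⇒*-self (inj₁ refl) = refl
IsUnitDet⇒*-self (inj₂ refl) = refl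

-- With B = A(H) and X = A(G), rooted X = I ⊗ B + X ⊗ E_vv is the adjacency matrix of G ∘ H^(v),
-- vertex combine i a being vertex a of the i-th copy of H.
module RootedProduct {k} (B : Matrix (suc k)) (B-sym : ∀ a b → B a b ≡ B b a) (v : Fin (suc k)) (n : ℕ) where

  open Blocks n (suc k)

  -- the (v, a) cofactor of B, i.e. the a-th entry of the v-th column of adj B
  cofactor : Fin (suc k) → ℤ
  cofactor a = det (B [ v ]≔ δ a)

  cofactor-B : ∀ b → sumFin (λ a → cofactor a * B a b) ≡ δ b v * det B
  cofactor-B b =
    trans (sumFin-cong (λ a → trans (ℤ.*-comm (cofactor a) (B a b)) (cong (_* cofactor a) (B-sym a b))))
          (det-cofactor-expansion B v b)

  isRoot : Fin (n ℕ.* suc k) → Bool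
  isRoot x = eqFin (inner x) v

  rooted : Matrix n → Matrix (n ℕ.* suc k)
  rooted X = blockMatrix (λ i a j b → δ i j * B a b + δ a v * (δ b v * X i j))

  rooted-nonRoot : ∀ X x → isRoot x ≡ false → ∀ y → rooted X x y ≡ blockDiagonal B x y
  rooted-nonRoot X x nonRoot y =
    trans (cong (λ e → blockDiagonal B x y + boolToℤ e * (δ (inner y) v * X (outer x) (outer y))) nonRoot)
          (ℤ.+-identityʳ (blockDiagonal B x y))

  sumFin-nonRoot-rows : ∀ (P : Matrix (n ℕ.* suc k)) (γ : Fin n → Fin (suc k) → ℤ) →
    (∀ j → γ j v ≡ 0ℤ) → (∀ s → isRoot s ≡ false → ∀ y → P s y ≡ blockDiagonal B s y) →
    ∀ y → sumFin (λ s → γ (outer s) (inner s) * P s y) ≡ sumFin (λ a → γ (outer y) a * B a (inner y))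
  sumFin-nonRoot-rows P γ γ-v P-nonRoot y = begin
    sumFin (λ s → γ (outer s) (inner s) * P s y)                     ≡⟨ sumFin-cong only-nonRoot ⟩
    sumFin (λ s → γ (outer s) (inner s) * blockDiagonal B s y)       ≡⟨ sumFin-blocks (λ j a → γ j a * (δ j i * B a b)) ⟩
    sumFin (λ j → sumFin (λ a → γ j a * (δ j i * B a b)))
      ≡⟨ sumFin-cong (λ j → trans (sumFin-cong (λ a → regroup (γ j a) (δ j i) (B a b))) (sumFin-*ʳ (δ j i) (λ a → γ j a * B a b))) ⟩
    sumFin (λ j → sumFin (λ a → γ j a * B a b) * δ j i)              ≡⟨ sumFin-δʳ i (λ j → sumFin (λ a → γ j a * B a b)) ⟩
    sumFin (λ a → γ i a * B a b)                                     ∎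
    where
    open ≡-Reasoning
    i = outer y
    b = inner y
    regroup : ∀ g d e → g * (d * e) ≡ (g * e) * d
    regroup = solve-∀
    only-nonRoot : ∀ s → γ (outer s) (inner s) * P s y ≡ γ (outer s) (inner s) * blockDiagonal B s y
    only-nonRoot s with isRoot s in root?
    ... | false = cong (γ (outer s) (inner s) *_) (P-nonRoot s root? y)
    ... | true  = trans (cong (_* P s y) γ≡0) (sym (cong (_* blockDiagonal B s y) γ≡0))
      where
      γ≡0 : γ (outer s) (inner s) ≡ 0ℤ
      γ≡0 = trans (cong (γ (outer s)) (eqFin⇒≡ root?)) (γ-v (outer s))

  open IsAlternatingMultilinear (det-isAlternatingMultilinear {n ℕ.* suc k}) using (row-operations)

  det-rooted-unitDet : ∀ X → IsUnitDet (det B) → det (minor B v v) ≡ 0ℤ → det (rooted X) ≡ det B ^ n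
  det-rooted-unitDet X unit minor≡0 =
    trans (row-operations (blockDiagonal B) (rooted X) isRoot coefficient (rooted-nonRoot X) root-rows unchanged-sources)
          (det-blockDiagonal n (suc k) B)
    where
    d = det B
    γ : Fin n → Fin n → Fin (suc k) → ℤ
    γ i j a = X i j * (d * cofactor a)
    γ-v : ∀ i j → γ i j v ≡ 0ℤ
    γ-v i j = trans (cong (λ c → X i j * (d * c)) (trans (det-[]≔δ-diag B v) minor≡0))
                    (trans (cong (X i j *_) (ℤ.*-zeroʳ d)) (ℤ.*-zeroʳ (X i j)))
    coefficient : Fin (n ℕ.* suc k) → Fin (n ℕ.* suc k) → ℤ
    coefficient x s = γ (outer x) (outer s) (inner s)
    unchanged-sources : ∀ x s → isRoot s ≡ true → coefficient x s ≡ 0ℤ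
    unchanged-sources x s root = trans (cong (γ (outer x) (outer s)) (eqFin⇒≡ root)) (γ-v (outer x) (outer s))
    root-rows : ∀ x → isRoot x ≡ true → ∀ y →
      rooted X x y ≡ blockDiagonal B x y + sumFin (λ s → coefficient x s * blockDiagonal B s y)
    root-rows x root y = cong (blockDiagonal B x y +_) (begin
      boolToℤ (isRoot x) * (δ b v * X i j)                ≡⟨ cong (λ e → boolToℤ e * (δ b v * X i j)) root ⟩
      1ℤ * (δ b v * X i j)                                ≡⟨ cong (_* (δ b v * X i j)) (sym (IsUnitDet⇒*-self unit)) ⟩
      (d * d) * (δ b v * X i j)                           ≡⟨ regroup d (δ b v) (X i j) ⟩
      (X i j * d) * (δ b v * d)                           ≡⟨ cong ((X i j * d) *_) (sym (cofactor-B b)) ⟩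
      (X i j * d) * sumFin (λ a → cofactor a * B a b)     ≡⟨ sym (sumFin-*ˡ (X i j * d) (λ a → cofactor a * B a b)) ⟩
      sumFin (λ a → (X i j * d) * (cofactor a * B a b))   ≡⟨ sumFin-cong (λ a → trans (sym (ℤ.*-assoc (X i j * d) (cofactor a) (B a b)))
                                                                    (cong (_* B a b) (ℤ.*-assoc (X i j) d (cofactor a)))) ⟩
      sumFin (λ a → γ i j a * B a b)                      ≡⟨ sym (sumFin-nonRoot-rows (blockDiagonal B) (γ i) (γ-v i) (λ _ _ _ → refl) y) ⟩
      sumFin (λ s → coefficient x s * blockDiagonal B s y) ∎)
      where
      open ≡-Reasoning
      i = outer x
      j = outer y
      b = inner y
      regroup : ∀ d e x → (d * d) * (e * x) ≡ (x * d) * (e * d)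
      regroup = solve-∀

  rootRows : Matrix n → Matrix (n ℕ.* suc k)
  rootRows Y x y = if isRoot x then δ (inner y) v * Y (outer x) (outer y) else blockDiagonal B x y

  rootRows-root : ∀ Y {x} → isRoot x ≡ true → ∀ y → rootRows Y x y ≡ δ (inner y) v * Y (outer x) (outer y)
  rootRows-root Y {x} root y = cong (λ e → if e then δ (inner y) v * Y (outer x) (outer y) else blockDiagonal B x y) root

  rootRows-nonRoot : ∀ Y {x} → isRoot x ≡ false → ∀ y → rootRows Y x y ≡ blockDiagonal B x y
  rootRows-nonRoot Y {x} nonRoot y = cong (λ e → if e then δ (inner y) v * Y (outer x) (outer y) else blockDiagonal B x y) nonRoot

  isRoot-combine : ∀ r → isRoot (combine r v) ≡ true
  isRoot-combine r = trans (cong (λ a → eqFin a v) (inner-combine r v)) (eqFin-refl v)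

  rootRows-combine : ∀ Y r y → rootRows Y (combine r v) y ≡ δ (inner y) v * Y r (outer y)
  rootRows-combine Y r y =
    trans (rootRows-root Y (isRoot-combine r) y) (cong (λ i → δ (inner y) v * Y i (outer y)) (outer-combine r v))

  rootRow : (Fin n → ℤ) → Fin (n ℕ.* suc k) → ℤ
  rootRow z y = δ (inner y) v * z (outer y)

  rootRows-[]≔ : ∀ Y r z → rootRows (Y [ r ]≔ z) ≋ rootRows Y [ combine r v ]≔ rootRow z
  rootRows-[]≔ Y r z x y with x Fin.≟ combine r v
  ... | yes refl = trans (rootRows-combine (Y [ r ]≔ z) r y)
                         (trans (cong (δ (inner y) v *_) ([]≔-updates Y r (outer y)))
                                (sym ([]≔-updates (rootRows Y) (combine r v) y)))
  ... | no x≢rv  = trans unchanged (sym ([]≔-minimal (rootRows Y) (combine r v) x≢rv y))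
    where
    unchanged : rootRows (Y [ r ]≔ z) x y ≡ rootRows Y x y
    unchanged with isRoot x in root?
    ... | false = refl
    ... | true  = cong (δ (inner y) v *_) ([]≔-minimal Y r outer≢r (outer y))
      where
      outer≢r : outer x ≢ r
      outer≢r outer≡r = x≢rv (trans (sym (combine-outer-inner x)) (cong₂ combine outer≡r (eqFin⇒≡ root?)))

  rootRows-isAlternatingMultilinear : IsAlternatingMultilinear (det ∘ rootRows)
  rootRows-isAlternatingMultilinear = record
    { isMultilinear = record
      { ≋-cong = λ Y≋Y′ → det-cong (λ x y →
          cong (λ e → if isRoot x then δ (inner y) v * e else blockDiagonal B x y) (Y≋Y′ (outer x) (outer y)))
      ; linear = linear-rootRows
      }
    ; alternating = λ Y {r} {s} r≢s Yr≗Ys → det-alternating (rootRows Y) (r≢s ∘ Fin.combine-injectiveˡ r v s v)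
        (λ y → trans (rootRows-combine Y r y) (trans (cong (δ (inner y) v *_) (Yr≗Ys (outer y))) (sym (rootRows-combine Y s y))))
    }
    where
    linear-rootRows : ∀ Y r a z₁ z₂ →
      det (rootRows (Y [ r ]≔ (λ j → a * z₁ j + z₂ j))) ≡ a * det (rootRows (Y [ r ]≔ z₁)) + det (rootRows (Y [ r ]≔ z₂))
    linear-rootRows Y r a z₁ z₂ = begin
      det (rootRows (Y [ r ]≔ (λ j → a * z₁ j + z₂ j)))
        ≡⟨ det-cong (rootRows-[]≔ Y r _) ⟩
      det (rootRows Y [ combine r v ]≔ rootRow (λ j → a * z₁ j + z₂ j))
        ≡⟨ det-cong ([]≔-cong (rootRows Y) (combine r v) (λ y → distrib (δ (inner y) v) a (z₁ (outer y)) (z₂ (outer y)))) ⟩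
      det (rootRows Y [ combine r v ]≔ (λ y → a * rootRow z₁ y + rootRow z₂ y))
        ≡⟨ det-linear (rootRows Y) (combine r v) a (rootRow z₁) (rootRow z₂) ⟩
      a * det (rootRows Y [ combine r v ]≔ rootRow z₁) + det (rootRows Y [ combine r v ]≔ rootRow z₂)
        ≡⟨ sym (cong₂ (λ p q → a * p + q) (det-cong (rootRows-[]≔ Y r z₁)) (det-cong (rootRows-[]≔ Y r z₂))) ⟩
      a * det (rootRows (Y [ r ]≔ z₁)) + det (rootRows (Y [ r ]≔ z₂))
        ∎
      where
      open ≡-Reasoning
      distrib : ∀ e a x y → e * (a * x + y) ≡ a * (e * x) + e * y
      distrib = solve-∀

  rootRows-identity : rootRows identity ≋ blockDiagonal (B [ v ]≔ δ v)
  rootRows-identity x y with isRoot x in root?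
  ... | true  = trans (ℤ.*-comm (δ (inner y) v) (δ (outer x) (outer y)))
                      (cong (δ (outer x) (outer y) *_) (trans (δ-sym (inner y) v)
                        (sym (trans (cong (λ a → (B [ v ]≔ δ v) a (inner y)) (eqFin⇒≡ root?)) ([]≔-updates B v (inner y))))))
  ... | false = cong (δ (outer x) (outer y) *_) (sym ([]≔-minimal B v (eqFin⇒≢ root?) (inner y)))

  det-rooted-singular : ∀ X → det B ≡ 0ℤ → IsUnitDet (det (minor B v v)) → det (rooted X) ≡ det X * det (minor B v v) ^ n
  det-rooted-singular X singular unit = begin
    det (rooted X)                     ≡⟨ sym (row-operations (rooted X) (rootRows X) isRoot coefficient fixed root-rows unchanged-sources) ⟩
    det (rootRows X)                   ≡⟨ alternatingMultilinear-det rootRows-isAlternatingMultilinear X ⟩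
    det X * det (rootRows identity)    ≡⟨ cong (det X *_) (trans (det-cong rootRows-identity) (det-blockDiagonal n (suc k) (B [ v ]≔ δ v))) ⟩
    det X * det (B [ v ]≔ δ v) ^ n     ≡⟨ cong (λ e → det X * e ^ n) (det-[]≔δ-diag B v) ⟩
    det X * dᵥ ^ n                     ∎
    where
    open ≡-Reasoning
    dᵥ = det (minor B v v)
    -- root rows must not be used as sources, so the v-th cofactor is dropped
    deleted : Fin (suc k) → ℤ
    deleted = cofactor [ v ]≔ 0ℤ
    deleted-B : ∀ b → sumFin (λ a → deleted a * B a b) ≡ - (dᵥ * B v b)
    deleted-B b = trans (sumFin-[]≔0 cofactor (λ a → B a b) v)
                        (trans (cong₂ _-_ (trans (cofactor-B b) (trans (cong (δ b v *_) singular) (ℤ.*-zeroʳ (δ b v))))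
                                          (cong (_* B v b) (det-[]≔δ-diag B v)))
                               (ℤ.+-identityˡ (- (dᵥ * B v b))))
    γ : Fin n → Fin n → Fin (suc k) → ℤ
    γ i j a = δ i j * (dᵥ * deleted a)
    γ-v : ∀ i j → γ i j v ≡ 0ℤ
    γ-v i j = trans (cong (λ e → δ i j * (dᵥ * e)) (updateAt-updates v cofactor))
                    (trans (cong (δ i j *_) (ℤ.*-zeroʳ dᵥ)) (ℤ.*-zeroʳ (δ i j)))
    coefficient : Fin (n ℕ.* suc k) → Fin (n ℕ.* suc k) → ℤ
    coefficient x s = γ (outer x) (outer s) (inner s)
    unchanged-sources : ∀ x s → isRoot s ≡ true → coefficient x s ≡ 0ℤ
    unchanged-sources x s root = trans (cong (γ (outer x) (outer s)) (eqFin⇒≡ root)) (γ-v (outer x) (outer s))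
    fixed : ∀ x → isRoot x ≡ false → ∀ y → rootRows X x y ≡ rooted X x y
    fixed x nonRoot y = trans (rootRows-nonRoot X nonRoot y) (sym (rooted-nonRoot X x nonRoot y))
    root-rows : ∀ x → isRoot x ≡ true → ∀ y → rootRows X x y ≡ rooted X x y + sumFin (λ s → coefficient x s * rooted X s y)
    root-rows x root y = sym (begin
      rooted X x y + sumFin (λ s → coefficient x s * rooted X s y)
        ≡⟨ cong₂ _+_ (cong (λ a → δ i j * B a b + δ a v * (δ b v * X i j)) (eqFin⇒≡ root))
                     (sumFin-nonRoot-rows (rooted X) (γ i) (γ-v i) (rooted-nonRoot X) y) ⟩
      (δ i j * B v b + δ v v * (δ b v * X i j)) + sumFin (λ a → γ i j a * B a b)
        ≡⟨ cong₂ (λ e f → (δ i j * B v b + e * (δ b v * X i j)) + f) (δ-refl v) (removed-root b) ⟩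
      (δ i j * B v b + 1ℤ * (δ b v * X i j)) + δ i j * (dᵥ * - (dᵥ * B v b))
        ≡⟨ regroup (δ i j) (B v b) (δ b v * X i j) dᵥ ⟩
      δ b v * X i j + (δ i j * B v b) * (1ℤ - dᵥ * dᵥ)
        ≡⟨ cong (λ e → δ b v * X i j + (δ i j * B v b) * (1ℤ - e)) (IsUnitDet⇒*-self unit) ⟩
      δ b v * X i j + (δ i j * B v b) * (1ℤ - 1ℤ)
        ≡⟨ vanish (δ b v * X i j) (δ i j * B v b) ⟩
      δ b v * X i j
        ≡⟨ sym (rootRows-root X root y) ⟩
      rootRows X x y                                       ∎)
      where
      i = outer x
      j = outer y
      b = inner y
      removed-root : ∀ b → sumFin (λ a → γ i j a * B a b) ≡ δ i j * (dᵥ * - (dᵥ * B v b))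
      removed-root b = trans (sumFin-cong (λ a → trans (ℤ.*-assoc (δ i j) (dᵥ * deleted a) (B a b))
                                                        (cong (δ i j *_) (ℤ.*-assoc dᵥ (deleted a) (B a b)))))
                             (trans (sumFin-*ˡ (δ i j) (λ a → dᵥ * (deleted a * B a b)))
                                    (cong (δ i j *_) (trans (sumFin-*ˡ dᵥ (λ a → deleted a * B a b)) (cong (dᵥ *_) (deleted-B b)))))
      regroup : ∀ e β q d → (e * β + 1ℤ * q) + e * (d * - (d * β)) ≡ q + (e * β) * (1ℤ - d * d)
      regroup = solve-∀
      vanish : ∀ q p → q + p * (1ℤ - 1ℤ) ≡ q
      vanish = solve-∀

rootedProductAdj-blocks : ∀ {n k} (G : Graph n) (H : Graph k) v x y → let open Blocks n k in
  rootedProductAdj G H v x y ≡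
    (eqFin (outer x) (outer y) ∧ adj H (inner x) (inner y)) ∨ (eqFin (inner x) v ∧ eqFin (inner y) v ∧ adj G (outer x) (outer y))
rootedProductAdj-blocks {n} {k} G H v x y with remQuot {n} k x | remQuot {n} k y
... | i , a | j , b = refl

root-loop-free : ∀ {k} (H : Graph k) v a b {p q} → p ∧ adj H a b ≡ true → eqFin a v ∧ (eqFin b v ∧ q) ≡ false
root-loop-free H v a b {p} edge with eqFin a v in a≟v | eqFin b v in b≟v
... | false | _     = refl
... | true  | false = refl
... | true  | true  with () ← trans (sym (∧-conicalʳ p _ edge))
                                    (trans (cong₂ (adj H) (eqFin⇒≡ a≟v) (eqFin⇒≡ b≟v)) (adj-irrefl H v))

A-sym : ∀ {k} (H : Graph k) a b → A H a b ≡ A H b a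
A-sym H a b = cong boolToℤ (adj-sym H a b)

A-rooted≋rooted : ∀ {n k} (G : Graph n) (H : Graph (suc k)) v → A-rooted G H v ≋ RootedProduct.rooted (A H) (A-sym H) v n (A G)
A-rooted≋rooted {n} {k} G H v x y =
  trans (cong boolToℤ (rootedProductAdj-blocks G H v x y))
        (trans (boolToℤ-∨ (eqFin i j ∧ adj H a b) _ (root-loop-free H v a b))
               (cong₂ _+_ (boolToℤ-∧ (eqFin i j) (adj H a b))
                          (trans (boolToℤ-∧ (eqFin a v) _) (cong (δ a v *_) (boolToℤ-∧ (eqFin b v) (adj G i j))))))
  where
  open Blocks n (suc k)
  i = outer x
  j = outer y
  a = inner x
  b = inner y

corollary2 : ∀ {k} (H : Graph (suc k)) (v : Fin (suc k))
    → ((IsUnitDet (det (A H)) × det (A⁽ v ⁾ H) ≡ 0ℤ)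
       ⊎ (det (A H) ≡ 0ℤ × IsUnitDet (det (A⁽ v ⁾ H))))
    → ∀ {n} (G : Graph n) → IsUnitDet (det (A G))
    → IsUnitDet (det (A-rooted G H v))
corollary2 H v hypothesis {n} G unitG = subst IsUnitDet (sym (det-cong (A-rooted≋rooted G H v))) (unit hypothesis)
  where
  open RootedProduct (A H) (A-sym H) v n
  unit : (IsUnitDet (det (A H)) × det (A⁽ v ⁾ H) ≡ 0ℤ) ⊎ (det (A H) ≡ 0ℤ × IsUnitDet (det (A⁽ v ⁾ H))) →
         IsUnitDet (det (rooted (A G)))
  unit (inj₁ (unitH , singularMinor)) =
    subst IsUnitDet (sym (det-rooted-unitDet (A G) unitH singularMinor)) (IsUnitDet-^ unitH n)
  unit (inj₂ (singularH , unitMinor)) =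
    subst IsUnitDet (sym (det-rooted-singular (A G) singularH unitMinor)) (IsUnitDet-* unitG (IsUnitDet-^ unitMinor n))
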